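{- Let $u$ be a primitive word over $V$. Then $u$ is a non-ins-robust primitive word (i.e. $u \in Q_{\overline{I}}$) if and only if some cyclic permutation $u'$ of $u$ has a period $p$ such that $p$ divides $|u| + 1$ and $p \le |u|$.
   Context: $V$ is a finite alphabet with at least two distinct letters; $V^*$ is the set of all finite words over $V$, $|w|$ is the length of $w$. A cyclic permutation of a word $z$ is any word $yx$ where $z = xy$ with $x, y \in V^*$. A word $a_1 a_2 \cdots a_n$ ($a_i \in V$) has period $p$ (a positive integer) if $a_i = a_{i+p}$ for all $1 \le i \le n - p$. A nonempty word $w$ is primitive if it is not of the form $v^n$ for a word $v$ and an integer $n \ge 2$; $Q$ is the set of primitive words. For a word $w$ of length $n$, $w[1..i]$ denotes its prefix of length $i$ and $w[i+1..n]$ its suffix of length $n-i$. A primitive word $w$ of length $n$ is ins-robust if for every $i \in \{0,\ldots,n\}$ and every $a \in V$ the word $w[1..i]\,a\,w[i+1..n]$ is primitive; $Q_I$ is the set of ins-robust primitive words and $Q_{\overline{I}} = Q \setminus Q_I$. -}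

module Defs where

open import Data.Nat using (ℕ; _+_; _≤_; _≥_; NonZero)
open import Data.Fin using (Fin; toℕ)
open import Data.List using (List; []; _∷_; _++_; length; take; drop; concat; replicate; lookup)
open import Data.List.Membership.Propositional using (_∈_)
open import Data.Product using (Σ; ∃; _×_)
open import Relation.Nullary using (¬_)
open import Relation.Binary.PropositionalEquality using (_≡_)

Finite : Set → Set
Finite V = Σ (List V) (λ xs → ∀ (a : V) → a ∈ xs)

CyclicPerm : {V : Set} → List V → List V → Set
CyclicPerm {V} z z' = Σ (List V) λ x → Σ (List V) λ y → (z ≡ x ++ y) × (z' ≡ y ++ x)

HasPeriod : {V : Set} → List V → ℕ → Set
HasPeriod w p = NonZero p ×
  (∀ (i j : Fin (length w)) → toℕ j ≡ toℕ i + p → lookup w i ≡ lookup w j)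

Primitive : {V : Set} → List V → Set
Primitive {V} w = ¬ (w ≡ []) ×
  ¬ (Σ (List V) λ v → Σ ℕ λ n → (n ≥ 2) × (w ≡ concat (replicate n v)))

insertAt : {V : Set} → ℕ → V → List V → List V
insertAt i a w = take i w ++ (a ∷ drop i w)

InsRobust : {V : Set} → List V → Set
InsRobust {V} w = Primitive w ×
  (∀ (i : ℕ) → i ≤ length w → ∀ (a : V) → Primitive (insertAt i a w))

NonInsRobust : {V : Set} → List V → Set
NonInsRobust w = Primitive w × ¬ InsRobust w

-- Inserting a letter a at position i of u gives x a y with x y = u, and x a y is a
-- proper power v^k iff its rotation (y x) a is one, since conjugates of powers are
-- powers. A word of length n + 1 is a k-th power with k ≥ 2 iff it has a period p
-- with p ∣ n + 1 and p ≤ n; such a period of (y x) a restricts to y x, and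
-- conversely a period p ≤ n of y x extends to (y x) a by the letter that sits p
-- places before the end of y x.
module Submission where

open import Defs
open import Data.Nat using (ℕ; zero; suc; _+_; _*_; _∸_; _≤_; _<_; z≤n; s≤s; s≤s⁻¹; NonZero; >-nonZero⁻¹)
open import Data.Nat.Properties
  using ( +-comm; +-identityʳ; *-comm; m+n∸m≡n; m≤m+n; m≤n+m; 1+n≰n; m∸n≤m; ∸-monoʳ-<; m<m*n
        ; ≤-<-trans; nonZero?; m*n≢0⇒n≢0; anyUpTo?)
  renaming (_≟_ to _≟ℕ_)
open import Data.Nat.Divisibility using (_∣_; divides; _∣?_)
open import Data.List using (List; []; _∷_; _++_; _∷ʳ_; [_]; length; take; drop; concat; replicate; lookup)
open import Data.List.Properties
  using (++-conicalʳ; ++-assoc; ++-identityʳ; ∷ʳ-++; length-++; length-++-comm; length-drop; drop-[]; take++drop≡id)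
open import Data.List.Relation.Binary.Prefix.Heterogeneous using (Prefix; []; _∷_; _++ᵖ_)
open import Data.List.Relation.Binary.Prefix.Heterogeneous.Properties as Prefix using (fromPointwise; drop⁺)
import Data.List.Relation.Binary.Pointwise.Properties as Pointwise
open import Data.Maybe using (Maybe; just; nothing)
open import Data.Maybe.Properties using (just-injective)
open import Data.Fin using (Fin; toℕ; fromℕ<)
open import Data.Fin.Properties using (toℕ-fromℕ<; all?)
open import Data.Product using (Σ; ∃; _×_; _,_; proj₂)
open import Data.Empty using (⊥-elim)
open import Function using (_∘_; case_of_)
open import Function.Bundles using (_⇔_; mk⇔)
open import Relation.Nullary using (¬_; Dec)
open import Relation.Nullary.Decidable using (_×-dec_; _→-dec_; decidable-stable)
open import Relation.Binary.Definitions using (DecidableEquality)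
open import Relation.Binary.PropositionalEquality
  using (_≡_; refl; sym; trans; cong; cong₂; subst; module ≡-Reasoning)

private
  variable
    A : Set
    a c : A
    xs ys zs v w : List A
    j k n p : ℕ

length-∷ʳ : ∀ (xs : List A) a → length (xs ∷ʳ a) ≡ suc (length xs)
length-∷ʳ xs a = trans (length-++ xs) (+-comm (length xs) 1)

take-length-++ : ∀ (xs : List A) ys → take (length xs) (xs ++ ys) ≡ xs
take-length-++ []       ys = refl
take-length-++ (x ∷ xs) ys = cong (x ∷_) (take-length-++ xs ys)

drop-length-++ : ∀ (xs : List A) ys → drop (length xs) (xs ++ ys) ≡ ys
drop-length-++ []       ys = refl
drop-length-++ (x ∷ xs) ys = drop-length-++ xs ys

drop-∷ʳ : ∀ n (xs : List A) a → n ≤ length xs → drop n (xs ∷ʳ a) ≡ drop n xs ∷ʳ a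
drop-∷ʳ zero    xs       a _         = refl
drop-∷ʳ (suc n) (x ∷ xs) a (s≤s n≤) = drop-∷ʳ n xs a n≤

insertAt-++ : ∀ (xs : List A) a ys → insertAt (length xs) a (xs ++ ys) ≡ xs ++ a ∷ ys
insertAt-++ xs a ys
  rewrite take-length-++ xs ys | drop-length-++ xs ys = refl

infix 4 _⊑_
_⊑_ : List A → List A → Set
_⊑_ = Prefix _≡_

⊑-refl : xs ⊑ xs
⊑-refl = fromPointwise (Pointwise.refl refl)

⊑-trans : xs ⊑ ys → ys ⊑ zs → xs ⊑ zs
⊑-trans = Prefix.trans trans

⊑-++⁻ : ∀ ys → xs ⊑ ys ++ zs → length xs ≤ length ys → xs ⊑ ys
⊑-++⁻ []       []      _         = []
⊑-++⁻ (_ ∷ _)  []      _         = []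
⊑-++⁻ (_ ∷ ys) (e ∷ q) (s≤s len) = e ∷ ⊑-++⁻ ys q len

⊑-∷ʳ : xs ⊑ ys → length xs < length ys → ∃ λ a → xs ∷ʳ a ⊑ ys
⊑-∷ʳ {ys = y ∷ _} [] _ = y , refl ∷ []
⊑-∷ʳ (e ∷ q) (s≤s len) with a , q′ ← ⊑-∷ʳ q len = a , e ∷ q′

⊑⇒take≡ : xs ⊑ ys → n ≤ length xs → take n xs ≡ take n ys
⊑⇒take≡ {n = zero}  _       _         = refl
⊑⇒take≡ {n = suc n} (e ∷ q) (s≤s len) = cong₂ _∷_ e (⊑⇒take≡ q len)

-- Unlike lookup, at compares letters of lists of different lengths without Fin casts.
at : List A → ℕ → Maybe A
at []       _       = nothing
at (x ∷ xs) zero    = just x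
at (x ∷ xs) (suc j) = at xs j

at-drop : ∀ n (xs : List A) j → at (drop n xs) j ≡ at xs (n + j)
at-drop zero    xs       j = refl
at-drop (suc n) []       j = refl
at-drop (suc n) (x ∷ xs) j = at-drop n xs j

at-lookup : ∀ (xs : List A) (i : Fin (length xs)) → at xs (toℕ i) ≡ just (lookup xs i)
at-lookup (x ∷ xs) Fin.zero    = refl
at-lookup (x ∷ xs) (Fin.suc i) = at-lookup xs i

at-fromℕ< : ∀ (xs : List A) (j< : j < length xs) → at xs j ≡ just (lookup xs (fromℕ< j<))
at-fromℕ< xs j< = trans (cong (at xs) (sym (toℕ-fromℕ< j<))) (at-lookup xs (fromℕ< j<))

at≡just⇒< : ∀ (xs : List A) j → at xs j ≡ just a → j < length xs
at≡just⇒< (x ∷ xs) zero    _ = s≤s z≤n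
at≡just⇒< (x ∷ xs) (suc j) e = s≤s (at≡just⇒< xs j e)

at-⊑ : xs ⊑ ys → ∀ j → at xs j ≡ just a → at ys j ≡ just a
at-⊑ (refl ∷ _) zero    e = e
at-⊑ (_    ∷ q) (suc j) e = at-⊑ q j e

at⇒⊑ : (∀ j {a} → at xs j ≡ just a → at ys j ≡ just a) → xs ⊑ ys
at⇒⊑ {xs = []}                 _ = []
at⇒⊑ {xs = x ∷ xs} {ys = []}     h with () ← h 0 refl
at⇒⊑ {xs = x ∷ xs} {ys = y ∷ ys} h =
  just-injective (sym (h 0 refl)) ∷ at⇒⊑ (λ j → h (suc j))

-- Defs' HasPeriod additionally demands p ≠ 0; every list is Periodic 0.
Periodic : ℕ → List A → Set
Periodic p w = drop p w ⊑ w

periodic⇒hasPeriod : NonZero p → Periodic p w → HasPeriod w p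
periodic⇒hasPeriod {p = p} {w = w} nz per = nz , λ i j j≡i+p → just-injective (begin
  just (lookup w i)  ≡⟨ at-lookup w i ⟨
  at w (toℕ i)       ≡⟨ at-⊑ per (toℕ i) (begin
    at (drop p w) (toℕ i) ≡⟨ at-drop p w (toℕ i) ⟩
    at w (p + toℕ i)      ≡⟨ cong (at w) (trans (+-comm p (toℕ i)) (sym j≡i+p)) ⟩
    at w (toℕ j)          ≡⟨ at-lookup w j ⟩
    just (lookup w j)     ∎) ⟩
  just (lookup w j)  ∎)
  where open ≡-Reasoning

hasPeriod⇒periodic : HasPeriod w p → Periodic p w
hasPeriod⇒periodic {w = w} {p = p} (_ , per) = at⇒⊑ λ j e →
  let e′  = trans (sym (at-drop p w j)) e
      k<  = at≡just⇒< w (p + j) e′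
      j<  = ≤-<-trans (m≤n+m j p) k<
      i≡k = per (fromℕ< j<) (fromℕ< k<)
              (trans (toℕ-fromℕ< k<) (trans (+-comm p j) (cong (_+ p) (sym (toℕ-fromℕ< j<)))))
  in trans (at-fromℕ< w j<) (trans (cong just i≡k) (trans (sym (at-fromℕ< w k<)) e′))

periodic-[] : {A : Set} → ∀ p → Periodic {A} p []
periodic-[] {A} p rewrite drop-[] {A = A} p = []

periodic-++⁻ : ∀ xs → Periodic p (xs ++ ys) → Periodic p xs
periodic-++⁻ {p = p} {ys = ys} xs per =
  ⊑-++⁻ xs (⊑-trans (drop⁺ p (⊑-refl ++ᵖ ys)) per)
    (subst (_≤ length xs) (sym (length-drop p xs)) (m∸n≤m (length xs) p))

length-drop-< : ∀ p (xs : List A) → NonZero p → p ≤ length xs → length (drop p xs) < length xs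
length-drop-< p xs nz p≤ rewrite length-drop p xs = ∸-monoʳ-< (>-nonZero⁻¹ p {{nz}}) p≤

periodic-∷ʳ : NonZero p → p ≤ length w → Periodic p w → ∃ λ a → Periodic p (w ∷ʳ a)
periodic-∷ʳ {p = p} {w = w} nz p≤ per with a , q ← ⊑-∷ʳ per (length-drop-< p w nz p≤) =
  a , subst (_⊑ w ∷ʳ a) (sym (drop-∷ʳ p w a p≤)) (q ++ᵖ [ a ])

_^_ : List A → ℕ → List A
v ^ k = concat (replicate k v)

length-^ : ∀ (v : List A) k → length (v ^ k) ≡ k * length v
length-^ v zero    = refl
length-^ v (suc k) = trans (length-++ v) (cong (length v +_) (length-^ v k))

[]-^ : {A : Set} → ∀ k → [] ^ k ≡ ([] {A = A})
[]-^ zero    = refl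
[]-^ (suc k) = []-^ k

^-shift : ∀ (xs ys : List A) k → (xs ++ ys) ^ k ++ xs ≡ xs ++ (ys ++ xs) ^ k
^-shift xs ys zero    = sym (++-identityʳ xs)
^-shift xs ys (suc k) = begin
  ((xs ++ ys) ++ (xs ++ ys) ^ k) ++ xs   ≡⟨ ++-assoc (xs ++ ys) _ xs ⟩
  (xs ++ ys) ++ ((xs ++ ys) ^ k ++ xs)   ≡⟨ cong ((xs ++ ys) ++_) (^-shift xs ys k) ⟩
  (xs ++ ys) ++ (xs ++ (ys ++ xs) ^ k)   ≡⟨ ++-assoc xs ys _ ⟩
  xs ++ (ys ++ (xs ++ (ys ++ xs) ^ k))   ≡⟨ cong (xs ++_) (++-assoc ys xs _) ⟨
  xs ++ ((ys ++ xs) ++ (ys ++ xs) ^ k)   ∎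
  where open ≡-Reasoning

^-⊑-^suc : ∀ (v : List A) k → v ^ k ⊑ v ^ suc k
^-⊑-^suc v zero    = []
^-⊑-^suc v (suc k) = Prefix.++⁺ (Pointwise.refl refl) (^-⊑-^suc v k)

^-periodic : ∀ (v : List A) k → Periodic (length v) (v ^ k)
^-periodic v zero    = periodic-[] (length v)
^-periodic v (suc k) rewrite drop-length-++ v (v ^ k) = ^-⊑-^suc v k

∷-^⇒∷ʳ-^ : c ∷ xs ≡ v ^ k → ∃ λ v′ → xs ∷ʳ c ≡ v′ ^ k
∷-^⇒∷ʳ-^ {v = []}     {k = suc k} e with () ← trans e ([]-^ k)
∷-^⇒∷ʳ-^ {v = c ∷ v₀} {k = suc k} refl =
  v₀ ∷ʳ c , (begin
    (v₀ ++ (c ∷ v₀) ^ k) ∷ʳ c   ≡⟨ ++-assoc v₀ ((c ∷ v₀) ^ k) [ c ] ⟩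
    v₀ ++ (c ∷ v₀) ^ k ∷ʳ c     ≡⟨ cong (v₀ ++_) (^-shift [ c ] v₀ k) ⟩
    v₀ ++ c ∷ (v₀ ∷ʳ c) ^ k     ≡⟨ ∷ʳ-++ v₀ c _ ⟨
    (v₀ ∷ʳ c) ^ suc k           ∎)
  where open ≡-Reasoning

rotate-^ : ∀ xs → xs ++ ys ≡ v ^ k → ∃ λ v′ → ys ++ xs ≡ v′ ^ k
rotate-^ {ys = ys} {v = v} []       e = v , trans (++-identityʳ ys) e
rotate-^ {ys = ys} {k = k} (c ∷ xs) e
  with v₁ , e₁ ← ∷-^⇒∷ʳ-^ {k = k} e
  with v₂ , e₂ ← rotate-^ {k = k} xs (trans (sym (++-assoc xs ys [ c ])) e₁)
  = v₂ , trans (sym (∷ʳ-++ ys c xs)) e₂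

periodic⇒^ : ∀ k → Periodic p w → length w ≡ k * p → w ≡ take p w ^ k
periodic⇒^ {w = []}       zero       _   _   = refl
periodic⇒^ {p = p} {w = w} (suc k) per len = begin
  w                                  ≡⟨ take++drop≡id p w ⟨
  take p w ++ drop p w               ≡⟨ cong (take p w ++_) (periodic⇒^ k (drop⁺ p per) len′) ⟩
  take p w ++ take p (drop p w) ^ k  ≡⟨ cong (take p w ++_) (same-block k len′) ⟩
  take p w ++ take p w ^ k           ∎
  where
  open ≡-Reasoning
  len′ : length (drop p w) ≡ k * p
  len′ = trans (length-drop p w) (trans (cong (_∸ p) len) (m+n∸m≡n p (k * p)))
  same-block : ∀ k → length (drop p w) ≡ k * p → take p (drop p w) ^ k ≡ take p w ^ k
  same-block zero    _ = refl
  same-block (suc k) l =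
    cong (_^ suc k) (⊑⇒take≡ per (subst (p ≤_) (sym l) (m≤m+n p (k * p))))

∷ʳ-^⇒period : w ∷ʳ a ≡ v ^ k → 2 ≤ k →
  Σ ℕ λ p → HasPeriod w p × p ∣ suc (length w) × p ≤ length w
∷ʳ-^⇒period {w = w} {a} {v} {k} e 2≤k =
  length v , periodic⇒hasPeriod nz per , divides k len , s≤s⁻¹ p<1+n
  where
  len : suc (length w) ≡ k * length v
  len = trans (sym (length-∷ʳ w a)) (trans (cong length e) (length-^ v k))
  nz : NonZero (length v)
  nz = m*n≢0⇒n≢0 k {{subst NonZero len _}}
  per : Periodic (length v) w
  per = periodic-++⁻ {p = length v} w (subst (Periodic (length v)) (sym e) (^-periodic v k))
  p<1+n : length v < suc (length w)
  p<1+n = subst (length v <_) (trans (*-comm (length v) k) (sym len)) (m<m*n (length v) k {{nz}} 2≤k)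

period⇒∷ʳ-^ : HasPeriod w p → p ∣ suc (length w) → p ≤ length w →
  Σ _ λ a → Σ (List _) λ v → Σ ℕ λ k → 2 ≤ k × w ∷ʳ a ≡ v ^ k
period⇒∷ʳ-^ {w = w} {p} hp@(nz , _) (divides k len) p≤
  with a , per ← periodic-∷ʳ nz p≤ (hasPeriod⇒periodic hp) =
  a , take p (w ∷ʳ a) , k , 2≤ k len , periodic⇒^ k per (trans (length-∷ʳ w a) len)
  where
  2≤ : ∀ k → suc (length w) ≡ k * p → 2 ≤ k
  2≤ zero          ()
  2≤ (suc zero)    e = ⊥-elim (1+n≰n (subst (_≤ length w) (sym (trans e (+-identityʳ p))) p≤))
  2≤ (suc (suc k)) _ = s≤s (s≤s z≤n)

rotation : ℕ → List A → List A
rotation i u = drop i u ++ take i u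

length-rotation : ∀ i (u : List A) → length (rotation i u) ≡ length u
length-rotation i u = trans (length-++-comm (drop i u) (take i u)) (cong length (take++drop≡id i u))

rotation-cyclicPerm : ∀ i (u : List A) → CyclicPerm u (rotation i u)
rotation-cyclicPerm i u = take i u , drop i u , sym (take++drop≡id i u) , refl

insert-^⇒rotation-∷ʳ-^ : ∀ xs (a : A) ys → xs ++ a ∷ ys ≡ v ^ k → ∃ λ v′ → (ys ++ xs) ∷ʳ a ≡ v′ ^ k
insert-^⇒rotation-∷ʳ-^ {k = k} xs a ys e
  with v′ , e′ ← rotate-^ {k = k} (xs ∷ʳ a) (trans (∷ʳ-++ xs a ys) e)
  = v′ , trans (++-assoc ys xs [ a ]) e′

rotation-∷ʳ-^⇒insert-^ : ∀ xs (a : A) ys → (ys ++ xs) ∷ʳ a ≡ v ^ k → ∃ λ v′ → xs ++ a ∷ ys ≡ v′ ^ k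
rotation-∷ʳ-^⇒insert-^ {k = k} xs a ys e
  with v′ , e′ ← rotate-^ {k = k} ys (trans (sym (++-assoc ys xs [ a ])) e)
  = v′ , trans (sym (∷ʳ-++ xs a ys)) e′

CyclicPeriod : List A → Set
CyclicPeriod {A} u = Σ (List A) λ u′ → CyclicPerm u u′ × Σ ℕ λ p →
  HasPeriod u′ p × p ∣ suc (length u) × p ≤ length u

-- CyclicPeriod with the rotation made canonical and both quantifiers bounded, hence decidable.
RotationPeriod : List A → Set
RotationPeriod u = ∃ λ i → i < suc (length u) × ∃ λ p → p < suc (length u) ×
  HasPeriod (rotation i u) p × p ∣ suc (length u)

hasPeriod? : DecidableEquality A → ∀ w p → Dec (HasPeriod w p)
hasPeriod? _≟_ w p = nonZero? p ×-dec all? λ i → all? λ j →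
  (toℕ j ≟ℕ toℕ i + p) →-dec (lookup w i ≟ lookup w j)

rotationPeriod? : DecidableEquality A → ∀ (u : List A) → Dec (RotationPeriod u)
rotationPeriod? _≟_ u = anyUpTo? (λ i → anyUpTo? (λ p →
  hasPeriod? _≟_ (rotation i u) p ×-dec p ∣? suc (length u)) (suc (length u))) (suc (length u))

rotationPeriod⇒cyclicPeriod : ∀ (u : List A) → RotationPeriod u → CyclicPeriod u
rotationPeriod⇒cyclicPeriod u (i , _ , p , p<1+n , hp , p∣) =
  rotation i u , rotation-cyclicPerm i u , p , hp , p∣ , s≤s⁻¹ p<1+n

insert-^⇒rotationPeriod : ∀ (u : List A) i → i ≤ length u → insertAt i a u ≡ v ^ k → 2 ≤ k →
  RotationPeriod u
insert-^⇒rotationPeriod {a = a} {k = k} u i i≤n e 2≤k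
  with v′ , e′ ← insert-^⇒rotation-∷ʳ-^ {k = k} (take i u) a (drop i u) e
  with p , hp , p∣ , p≤ ← ∷ʳ-^⇒period e′ 2≤k
  = i , s≤s i≤n , p , s≤s (subst (p ≤_) (length-rotation i u) p≤) ,
    hp , subst (λ n → p ∣ suc n) (length-rotation i u) p∣

¬rotationPeriod⇒insRobust : ∀ {u : List A} → Primitive u → ¬ RotationPeriod u → InsRobust u
¬rotationPeriod⇒insRobust {u = u} u-primitive ¬rp = u-primitive , λ i i≤n a →
  (λ e → case ++-conicalʳ (take i u) (a ∷ drop i u) e of λ ()) ,
  λ (v , k , 2≤k , e) → ¬rp (insert-^⇒rotationPeriod u i i≤n e 2≤k)

cyclicPeriod⇒¬insRobust : ∀ {u : List A} → CyclicPeriod u → ¬ InsRobust u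
cyclicPeriod⇒¬insRobust (_ , (x , y , refl , refl) , p , hp , p∣ , p≤) (_ , robust)
  with a , v , k , 2≤k , e ←
         period⇒∷ʳ-^ hp (subst (λ n → p ∣ suc n) (length-++-comm x y) p∣) (subst (p ≤_) (length-++-comm x y) p≤)
  with v′ , e′ ← rotation-∷ʳ-^⇒insert-^ {k = k} x a y e
  = proj₂ (robust (length x) x≤n a) (v′ , k , 2≤k , trans (insertAt-++ x a y) e′)
  where
  x≤n = subst (length x ≤_) (sym (length-++ x)) (m≤m+n (length x) (length y))

-- The witness for ⇒ comes from deciding RotationPeriod.
corollary26 : {V : Set} → Finite V → DecidableEquality V →
    Σ V (λ a → Σ V (λ b → ¬ (a ≡ b))) →
    (u : List V) → Primitive u →
    NonInsRobust u ⇔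
      Σ (List V) (λ u′ → CyclicPerm u u′ × Σ ℕ (λ p →
        HasPeriod u′ p × (p ∣ suc (length u)) × (p ≤ length u)))
corollary26 _ _≟_ _ u u-primitive = mk⇔
  (λ (_ , ¬robust) → rotationPeriod⇒cyclicPeriod u (decidable-stable (rotationPeriod? _≟_ u)
    (¬robust ∘ ¬rotationPeriod⇒insRobust u-primitive)))
  (λ cp → u-primitive , cyclicPeriod⇒¬insRobust cp)
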